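{- Let $k$ be an odd positive integer and $r \in \{1,3\}$. Let $\Omega = \mathbb{Z}_8 \times \mathbb{Z}_k \times \mathbb{Z}_r$. Define permutations of $\Omega$ as follows: $\tau_1$ maps $(i,j,\ell)\mapsto (i^{\sigma_1}, j,\ell)$ where $\sigma_1$ is the permutation $(0\ 1\ 2\ 3\ 4\ 5\ 6\ 7)$ of $\mathbb{Z}_8$; $\tau_2$ maps $(i,j,\ell)\mapsto (i^{\sigma_2}, j,\ell)$ where $\sigma_2$ is the permutation $(0\ 1\ 6\ 7\ 4\ 5\ 2\ 3)$ of $\mathbb{Z}_8$; $\rho_1$ maps $(i,j,\ell)$ to $(i,j+1,\ell)$ if $i$ is even and to $(i,j-1,\ell)$ if $i$ is odd; $\rho_2$ maps $(i,j,\ell)$ to $(i,j,\ell+1)$ if $i$ is even and to $(i,j,\ell-1)$ if $i$ is odd (addition in $\mathbb{Z}_k$, respectively $\mathbb{Z}_r$). Let $R_1 = \langle \tau_1,\rho_1,\rho_2\rangle$, $R_2 = \langle \tau_2,\rho_1,\rho_2\rangle$ and $G = \langle R_1, R_2\rangle$. Then there is no $g \in G$ such that $g^{ -1}R_2 g = R_1$.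
   Context: Permutations act on the right; $R^g$ denotes $g^{ -1}Rg$. -}

module Defs where

open import Data.Nat using (ℕ; zero; suc; _+_; _∸_; _%_)
open import Data.Nat.DivMod using (_mod_)
open import Data.Fin using (Fin; toℕ)
open import Data.Vec using (Vec; []; _∷_; lookup)
open import Data.Bool using (Bool; true; false; not; if_then_else_; T)
open import Data.Product using (_×_; _,_; proj₁; proj₂; ∃; ∃-syntax)
open import Data.List using (List; []; _∷_; reverse; map)
open import Data.List.Relation.Unary.All using (All)
open import Relation.Binary.PropositionalEquality using (_≡_)
open import Relation.Nullary using (does)
open import Data.Nat using (_≟_)
open import Data.Fin using (#_)

Ω : ℕ → ℕ → Set
Ω k r = Fin 8 × Fin k × Fin r

inc : ∀ {n} → Fin n → Fin n
inc {suc n} i = (toℕ i + 1) mod suc n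

dec : ∀ {n} → Fin n → Fin n
dec {suc n} i = (toℕ i + n) mod suc n

-- σ₁ = (0 1 2 3 4 5 6 7) and σ₂ = (0 1 6 7 4 5 2 3) on ℤ₈ and their inverses,
-- given by their tables of images i ↦ i^σ.
σ₁ σ₁⁻¹ σ₂ σ₂⁻¹ : Fin 8 → Fin 8
σ₁   = lookup (# 1 ∷ # 2 ∷ # 3 ∷ # 4 ∷ # 5 ∷ # 6 ∷ # 7 ∷ # 0 ∷ [])
σ₁⁻¹ = lookup (# 7 ∷ # 0 ∷ # 1 ∷ # 2 ∷ # 3 ∷ # 4 ∷ # 5 ∷ # 6 ∷ [])
σ₂   = lookup (# 1 ∷ # 6 ∷ # 3 ∷ # 0 ∷ # 5 ∷ # 2 ∷ # 7 ∷ # 4 ∷ [])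
σ₂⁻¹ = lookup (# 3 ∷ # 0 ∷ # 5 ∷ # 2 ∷ # 7 ∷ # 4 ∷ # 1 ∷ # 6 ∷ [])

isEven : Fin 8 → Bool
isEven i = does (toℕ i % 2 ≟ 0)

data Gen : Set where
  τ₁ τ₂ ρ₁ ρ₂ : Gen

act : ∀ {k r} → Gen → Bool → Ω k r → Ω k r
act τ₁ false (i , j , l) = σ₁ i , j , l
act τ₁ true  (i , j , l) = σ₁⁻¹ i , j , l
act τ₂ false (i , j , l) = σ₂ i , j , l
act τ₂ true  (i , j , l) = σ₂⁻¹ i , j , l
act ρ₁ false (i , j , l) = i , (if isEven i then inc j else dec j) , l
act ρ₁ true  (i , j , l) = i , (if isEven i then dec j else inc j) , l
act ρ₂ false (i , j , l) = i , j , (if isEven i then inc l else dec l)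
act ρ₂ true  (i , j , l) = i , j , (if isEven i then dec l else inc l)

-- A word in the generators and their inverses: (g , b) stands for g if b = false, g⁻¹ if b = true.
Word : Set
Word = List (Gen × Bool)

-- Permutations act on the right: the word w₁ w₂ ⋯ wₙ maps x to (⋯((x^{w₁})^{w₂})⋯)^{wₙ}.
eval : ∀ {k r} → Word → Ω k r → Ω k r
eval []            x = x
eval ((g , b) ∷ w) x = eval w (act g b x)

invWord : Word → Word
invWord w = reverse (map (λ p → proj₁ p , not (proj₂ p)) w)

inR₁ inR₂ inG : Gen → Bool
inR₁ τ₂ = false
inR₁ _  = true
inR₂ τ₁ = false
inR₂ _  = true
inG  _  = true

-- f : Ω → Ω lies in the subgroup of Sym(Ω) generated by the generators selected by S:
-- f is (pointwise) the product of a word in those generators and their inverses.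
InSub : ∀ k r → (Gen → Bool) → (Ω k r → Ω k r) → Set
InSub k r S f = ∃[ w ] (All (λ p → T (S (proj₁ p))) w × (∀ x → eval w x ≡ f x))

-- Conjugate h^g = g⁻¹ h g (right action): x ↦ ((x^{g⁻¹})^h)^g.
conj : ∀ {k r} → Word → (Ω k r → Ω k r) → Ω k r → Ω k r
conj g h x = eval g (h (eval (invWord g) x))

ConjR₂toR₁ : ∀ k r → Word → Set
ConjR₂toR₁ k r g =
  (∀ h → InSub k r inR₂ h → InSub k r inR₁ (conj g h))
  × (∀ f → InSub k r inR₁ f → ∃[ h ] (InSub k r inR₂ h × (∀ x → conj g h x ≡ f x)))

{-# OPTIONS --safe #-}
-- Only the ℤ₈ coordinate matters: the projection Ω → ℤ₈ is equivariant, and on ℤ₈ the maps τ₁, ρ₁, ρ₂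
-- act as translations i ↦ i + c while τ₂ acts as i ↦ 5i + 1. Since 5² ≡ 1 (mod 8), every word g acts on
-- ℤ₈ as i ↦ 5^ε i + c, where ε is the parity of the number of τ₂-letters in g, and words of R₁ act as
-- translations. If τ₂^g were a word u of R₁, then on ℤ₈ we would get t ∘ σ₂ = u ∘ t with t affine, and
-- comparing linear parts gives 5^(ε+1) ≡ 5^ε (mod 8), i.e. 5 ≡ 1. The hypotheses on k and r are used
-- only to make Ω nonempty.
module Submission where

open import Defs
open import Data.Nat using (ℕ; zero; suc; _*_; _+_; _%_)
open import Data.Nat.DivMod using (_mod_)
open import Data.Fin using (Fin; toℕ; #_)
import Data.Fin as Fin
open import Data.Fin.Properties using (all?; _≟_)
open import Data.Sum using (_⊎_; inj₁; inj₂)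
open import Data.Product using (_×_; _,_; proj₁; proj₂; ∃-syntax)
open import Data.List using ([]; _∷_; _++_; _∷ʳ_; reverse; map)
open import Data.List.Properties using (unfold-reverse)
open import Data.List.Relation.Unary.All using (All; []; _∷_)
open import Data.Bool using (Bool; true; false; not; _xor_; if_then_else_; T)
open import Data.Bool.Properties using (xor-identityʳ; not-¬)
open import Data.Unit using (tt)
open import Data.Empty using (⊥-elim)
open import Function using (id; _∘_)
open import Relation.Nullary using (¬_; Dec; ¬?)
open import Relation.Nullary.Decidable using (from-yes)
open import Relation.Binary.PropositionalEquality
  using (_≡_; _≗_; refl; trans; cong; module ≡-Reasoning)

open ≡-Reasoning

act₈ : Gen → Bool → Fin 8 → Fin 8
act₈ τ₁ false = σ₁
act₈ τ₁ true  = σ₁⁻¹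
act₈ τ₂ false = σ₂
act₈ τ₂ true  = σ₂⁻¹
act₈ ρ₁ _     = id
act₈ ρ₂ _     = id

eval₈ : Word → Fin 8 → Fin 8
eval₈ []            i = i
eval₈ ((g , b) ∷ w) i = eval₈ w (act₈ g b i)

proj₁-act : ∀ {k r} g b (x : Ω k r) → proj₁ (act g b x) ≡ act₈ g b (proj₁ x)
proj₁-act τ₁ false _ = refl
proj₁-act τ₁ true  _ = refl
proj₁-act τ₂ false _ = refl
proj₁-act τ₂ true  _ = refl
proj₁-act ρ₁ false _ = refl
proj₁-act ρ₁ true  _ = refl
proj₁-act ρ₂ false _ = refl
proj₁-act ρ₂ true  _ = refl

proj₁-eval : ∀ {k r} w (x : Ω k r) → proj₁ (eval w x) ≡ eval₈ w (proj₁ x)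
proj₁-eval []            x = refl
proj₁-eval ((g , b) ∷ w) x =
  trans (proj₁-eval w (act g b x)) (cong (eval₈ w) (proj₁-act g b x))

infix 4 _≗?_
_≗?_ : (f h : Fin 8 → Fin 8) → Dec (f ≗ h)
f ≗? h = all? λ i → f i ≟ h i

eval₈-++ : ∀ v w → eval₈ (v ++ w) ≗ eval₈ w ∘ eval₈ v
eval₈-++ []            w i = refl
eval₈-++ ((g , b) ∷ v) w i = eval₈-++ v w (act₈ g b i)

act₈-inverse : ∀ g b → act₈ g (not b) ∘ act₈ g b ≗ id
act₈-inverse τ₁ false = from-yes (σ₁⁻¹ ∘ σ₁ ≗? id)
act₈-inverse τ₁ true  = from-yes (σ₁ ∘ σ₁⁻¹ ≗? id)
act₈-inverse τ₂ false = from-yes (σ₂⁻¹ ∘ σ₂ ≗? id)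
act₈-inverse τ₂ true  = from-yes (σ₂ ∘ σ₂⁻¹ ≗? id)
act₈-inverse ρ₁ _ _   = refl
act₈-inverse ρ₂ _ _   = refl

eval₈-invWord : ∀ w → eval₈ (invWord w) ∘ eval₈ w ≗ id
eval₈-invWord []            i = refl
eval₈-invWord ((g , b) ∷ w) i = begin
  eval₈ (reverse ((g , not b) ∷ w⁻)) (eval₈ w (act₈ g b i))
    ≡⟨ cong (λ v → eval₈ v (eval₈ w (act₈ g b i))) (unfold-reverse (g , not b) w⁻) ⟩
  eval₈ (reverse w⁻ ∷ʳ (g , not b)) (eval₈ w (act₈ g b i))
    ≡⟨ eval₈-++ (reverse w⁻) _ _ ⟩
  act₈ g (not b) (eval₈ (invWord w) (eval₈ w (act₈ g b i)))
    ≡⟨ cong (act₈ g (not b)) (eval₈-invWord w (act₈ g b i)) ⟩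
  act₈ g (not b) (act₈ g b i)
    ≡⟨ act₈-inverse g b i ⟩
  i ∎
  where w⁻ = map (λ p → proj₁ p , not (proj₂ p)) w

-- j and l only lift i ∈ ℤ₈ to a point of Ω.
eval₈-conj : ∀ {k r} → Fin k → Fin r → ∀ g w (h : Ω k r → Ω k r) {h₈ : Fin 8 → Fin 8} →
             (∀ x → proj₁ (h x) ≡ h₈ (proj₁ x)) → eval w ≗ conj g h →
             eval₈ w ∘ eval₈ g ≗ eval₈ g ∘ h₈
eval₈-conj j l g w h {h₈} h-over w≗conj i = begin
  eval₈ w (eval₈ g i)                          ≡⟨ cong (eval₈ w) (proj₁-eval g x) ⟨
  eval₈ w (proj₁ y)                            ≡⟨ proj₁-eval w y ⟨
  proj₁ (eval w y)                             ≡⟨ cong proj₁ (w≗conj y) ⟩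
  proj₁ (eval g (h y⁻))                        ≡⟨ proj₁-eval g (h y⁻) ⟩
  eval₈ g (proj₁ (h y⁻))                       ≡⟨ cong (eval₈ g) (h-over y⁻) ⟩
  eval₈ g (h₈ (proj₁ y⁻))                      ≡⟨ cong (eval₈ g ∘ h₈) (proj₁-eval (invWord g) y) ⟩
  eval₈ g (h₈ (eval₈ (invWord g) (proj₁ y)))   ≡⟨ cong (eval₈ g ∘ h₈ ∘ eval₈ (invWord g)) (proj₁-eval g x) ⟩
  eval₈ g (h₈ (eval₈ (invWord g) (eval₈ g i))) ≡⟨ cong (eval₈ g ∘ h₈) (eval₈-invWord g i) ⟩
  eval₈ g (h₈ i)                               ∎
  where
  x  = i , j , l
  y  = eval g x
  y⁻ = eval (invWord g) y

affine : Bool → Fin 8 → Fin 8 → Fin 8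
affine s c i = ((if s then 5 else 1) * toℕ i + toℕ c) mod 8

affine-∘? : ∀ s s' → Dec (∀ c c' → affine s' c' ∘ affine s c ≗ affine (s xor s') (affine s' c' c))
affine-∘? s s' = all? λ c → all? λ c' → affine s' c' ∘ affine s c ≗? affine (s xor s') (affine s' c' c)

affine-∘ : ∀ s s' c c' → affine s' c' ∘ affine s c ≗ affine (s xor s') (affine s' c' c)
affine-∘ false false = from-yes (affine-∘? false false)
affine-∘ false true  = from-yes (affine-∘? false true)
affine-∘ true  false = from-yes (affine-∘? true false)
affine-∘ true  true  = from-yes (affine-∘? true true)

affine-linear-part-unique : ∀ {s s' c c'} → affine s c ≗ affine s' c' → s ≡ s'
affine-linear-part-unique {false} {false}         _  = refl
affine-linear-part-unique {true}  {true}          _  = refl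
affine-linear-part-unique {false} {true}  {c} {c'} eq =
  ⊥-elim (from-yes (all? λ c → all? λ c' → ¬? (affine false c ≗? affine true c')) c c' eq)
affine-linear-part-unique {true}  {false} {c} {c'} eq =
  ⊥-elim (from-yes (all? λ c → all? λ c' → ¬? (affine true c ≗? affine false c')) c c' eq)

isτ₂ : Gen → Bool
isτ₂ τ₂ = true
isτ₂ _  = false

affine-id : id ≗ affine false (# 0)
affine-id = from-yes (id ≗? affine false (# 0))

act₈-affine : ∀ g b → ∃[ c ] act₈ g b ≗ affine (isτ₂ g) c
act₈-affine τ₁ false = # 1 , from-yes (σ₁ ≗? affine false (# 1))
act₈-affine τ₁ true  = # 7 , from-yes (σ₁⁻¹ ≗? affine false (# 7))
act₈-affine τ₂ false = # 1 , from-yes (σ₂ ≗? affine true (# 1))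
act₈-affine τ₂ true  = # 3 , from-yes (σ₂⁻¹ ≗? affine true (# 3))
act₈-affine ρ₁ _     = # 0 , affine-id
act₈-affine ρ₂ _     = # 0 , affine-id

τ₂-parity : Word → Bool
τ₂-parity []            = false
τ₂-parity ((g , _) ∷ w) = isτ₂ g xor τ₂-parity w

eval₈-affine : ∀ w → ∃[ c ] eval₈ w ≗ affine (τ₂-parity w) c
eval₈-affine []            = # 0 , affine-id
eval₈-affine ((g , b) ∷ w) = affine s c c₀ , λ i → begin
  eval₈ w (act₈ g b i)              ≡⟨ w≗ (act₈ g b i) ⟩
  affine s c (act₈ g b i)           ≡⟨ cong (affine s c) (gb≗ i) ⟩
  affine s c (affine (isτ₂ g) c₀ i) ≡⟨ affine-∘ (isτ₂ g) s c₀ c i ⟩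
  affine (isτ₂ g xor s) (affine s c c₀) i ∎
  where
  s   = τ₂-parity w
  c   = proj₁ (eval₈-affine w)
  w≗  = proj₂ (eval₈-affine w)
  c₀  = proj₁ (act₈-affine g b)
  gb≗ = proj₂ (act₈-affine g b)

τ₂-parity-R₁ : ∀ {w} → All (λ p → T (inR₁ (proj₁ p))) w → τ₂-parity w ≡ false
τ₂-parity-R₁ []                     = refl
τ₂-parity-R₁ {(τ₁ , _) ∷ _} (_ ∷ p) = τ₂-parity-R₁ p
τ₂-parity-R₁ {(ρ₁ , _) ∷ _} (_ ∷ p) = τ₂-parity-R₁ p
τ₂-parity-R₁ {(ρ₂ , _) ∷ _} (_ ∷ p) = τ₂-parity-R₁ p

eval₈-translation : ∀ {w} → All (λ p → T (inR₁ (proj₁ p))) w → ∃[ d ] eval₈ w ≗ affine false d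
eval₈-translation {w} w∈R₁ with eval₈-affine w | τ₂-parity-R₁ w∈R₁
... | d , w≗ | parity≡false = d , λ i → trans (w≗ i) (cong (λ s → affine s d i) parity≡false)

σ₂-not-conjugate-to-translation : ∀ {u t : Fin 8 → Fin 8} s →
  ∃[ d ] u ≗ affine false d → ∃[ c ] t ≗ affine s c → ¬ (u ∘ t ≗ t ∘ σ₂)
σ₂-not-conjugate-to-translation {u} {t} s (d , u≗) (c , t≗) u∘t≗t∘σ₂ =
  not-¬ (xor-identityʳ s) (affine-linear-part-unique λ i → begin
    affine (s xor false) (affine false d c) i ≡⟨ affine-∘ s false c d i ⟨
    affine false d (affine s c i)            ≡⟨ cong (affine false d) (t≗ i) ⟨
    affine false d (t i)                     ≡⟨ u≗ (t i) ⟨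
    u (t i)                                  ≡⟨ u∘t≗t∘σ₂ i ⟩
    t (σ₂ i)                                 ≡⟨ t≗ (σ₂ i) ⟩
    affine s c (σ₂ i)                        ≡⟨ cong (affine s c) (proj₂ (act₈-affine τ₂ false) i) ⟩
    affine s c (affine true (# 1) i)         ≡⟨ affine-∘ true s (# 1) c i ⟩
    affine (not s) (affine s c (# 1)) i      ∎)

lemma2p1 : (k r : ℕ) → k % 2 ≡ 1 → (r ≡ 1 ⊎ r ≡ 3)
    → ¬ (∃[ g ] (All (λ p → T (inG (proj₁ p))) g × ConjR₂toR₁ k r g))
lemma2p1 zero    _ ()  _
lemma2p1 (suc k) r _ r≡1⊎3 (g , _ , R₂^g⊆R₁ , _)
  with R₂^g⊆R₁ (act τ₂ false) ((τ₂ , false) ∷ [] , tt ∷ [] , λ _ → refl)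
... | w , w∈R₁ , w≗τ₂^g =
  σ₂-not-conjugate-to-translation (τ₂-parity g) (eval₈-translation w∈R₁) (eval₈-affine g)
    (eval₈-conj Fin.zero (point r≡1⊎3) g w (act τ₂ false) (proj₁-act τ₂ false) w≗τ₂^g)
  where
  point : ∀ {r} → r ≡ 1 ⊎ r ≡ 3 → Fin r
  point (inj₁ refl) = Fin.zero
  point (inj₂ refl) = Fin.zero
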